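{- For all integers $q\ge 2$ and $n\ge q+2$, $$2^{(n/q)^{q-1}}\le N_3(q,n)\le 2^{n^{q-1}\log_2 n}.$$
   Context: For integers $k\ge 1$, $q\ge 1$, $n\ge k$, a monotone (tight) path of length $n$ in the complete $k$-uniform hypergraph on $[N]=\{1,\dots,N\}$ is given by integers $j_1<j_2<\dots<j_n$ in $[N]$ together with the $k$-element sets $\{j_i,j_{i+1},\dots,j_{i+k-1}\}$, $i=1,\dots,n-k+1$. $N_k(q,n)$ denotes the smallest integer $N$ such that for every coloring of all $k$-element subsets of $[N]$ with $q$ colors there is a monotone path of length $n$ all of whose $k$-sets receive the same color. -}

module Defs where

open import Data.Nat using (ℕ; zero; suc; _+_; _≤_; _<_)
open import Data.Fin using (Fin)
open import Data.Product using (_×_; ∃-syntax)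
open import Relation.Nullary using (¬_)
open import Relation.Binary.PropositionalEquality using (_≡_)

-- A q-colouring of the 3-element subsets of [N]: the colour of {a<b<c}
-- is χ a b c.  Only values on 1 ≤ a < b < c ≤ N are ever used.
Colouring3 : ℕ → Set
Colouring3 q = ℕ → ℕ → ℕ → Fin q

IsMonotonePath : ℕ → ℕ → (ℕ → ℕ) → Set
IsMonotonePath N n j =
  (∀ i → suc i < n → j i < j (suc i)) ×
  (∀ i → i < n → (1 ≤ j i) × (j i ≤ N))

IsMonochromatic3 : {q : ℕ} → Colouring3 q → ℕ → (ℕ → ℕ) → Fin q → Set
IsMonochromatic3 χ n j col =
  ∀ i → 2 + i < n → χ (j i) (j (suc i)) (j (suc (suc i))) ≡ col

Arrows3 : ℕ → ℕ → ℕ → Set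
Arrows3 q n N =
  (χ : Colouring3 q) →
  ∃[ j ] ∃[ col ] (IsMonotonePath N n j × IsMonochromatic3 χ n j col)

IsN3 : ℕ → ℕ → ℕ → Set
IsN3 q n N = Arrows3 q n N × (∀ M → M < N → ¬ Arrows3 q n M)

-- The proof determines N_3 exactly: for m ≥ 2, N_3(q, m + 2) = D + 1, where D is the number
-- of down-sets of the grid [m]^q with the product order.
--   * N_3 > D (DownSetColouring): place the down-sets on the vertices 1, …, D along a linear
--     extension of inclusion and colour a triple by a coordinate in which a "new point" grows;
--     a monochromatic path on m + 2 vertices would need m + 1 increasing values in [m].
--   * N_3 ≤ D + 1 (ArrowBound): in a colouring of [D + 1] without such a path, label each pair
--     by the lengths of the monochromatic paths starting with it; the labels give every vertex
--     a down-set, and these D + 1 down-sets are pairwise distinct, which is impossible.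
-- D is then estimated: D ≤ (m + 1)^(m^(q-1)) because a down-set is determined by its column
-- heights (Heights), and D ≥ 2^((t+1)^(q-1)) for t = ⌊(m - 1)/(q - 1)⌋ because the subsets of a
-- suitable antichain generate distinct down-sets (Antichain).  Points and sets of points are represented by
-- codes (elements of Fin), which makes every quantification in the argument decidable; the
-- first sections provide the counting and coding tools for this.
module Submission where

open import Defs
open import Data.Nat
  using (ℕ; zero; suc; _+_; _*_; _∸_; _^_; _≤_; _<_; z≤n; s≤s; _≤?_; _<?_; _/_; NonZero)
open import Data.Nat.Properties
open import Data.Nat.DivMod using (m/n*n≤m; m/n≤m; m≥n⇒m/n>0; m≡m%n+[m/n]*n; m%n<n)
open import Data.Fin as Fin
  using (Fin; zero; suc; toℕ; fromℕ<; inject≤; combine; finToFun; funToFin)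
import Data.Fin.Properties as FinP
open import Data.Maybe using (Maybe; just; nothing)
open import Data.Product using (_×_; _,_; ∃; ∃-syntax; proj₁; proj₂)
open import Data.Unit using (⊤; tt)
open import Data.Empty using (⊥; ⊥-elim)
open import Relation.Nullary using (¬_; Dec; yes; no)
open import Relation.Nullary.Negation using (contradiction)
open import Relation.Nullary.Decidable using (_×-dec_; _→-dec_; ¬?)
open import Relation.Binary using (tri<; tri≈; tri>)
open import Relation.Binary.PropositionalEquality
open import Function using (_∘_)
open import Algebra.Properties.CommutativeSemigroup *-commutativeSemigroup using (interchange)

indicator : {P : Set} → Dec P → ℕ
indicator (yes _) = 1
indicator (no _) = 0

indicator-true : {P : Set} (p? : Dec P) → P → indicator p? ≡ 1
indicator-true (yes _) _ = refl
indicator-true (no ¬p) p = contradiction p ¬p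

indicator-false : {P : Set} (p? : Dec P) → ¬ P → indicator p? ≡ 0
indicator-false (yes p) ¬p = contradiction p ¬p
indicator-false (no _) _ = refl

indicator-mono : {P Q : Set} (p? : Dec P) (q? : Dec Q) →
                 (P → Q) → indicator p? ≤ indicator q?
indicator-mono (yes p) (yes _) _ = ≤-refl
indicator-mono (yes p) (no ¬q) P⇒Q = contradiction (P⇒Q p) ¬q
indicator-mono (no _) _ _ = z≤n

count : ∀ {n} {P : Fin n → Set} → (∀ i → Dec (P i)) → ℕ
count {zero} _ = 0
count {suc n} P? = indicator (P? zero) + count (P? ∘ suc)

rank : ∀ {n} {P : Fin n → Set} → (∀ i → Dec (P i)) → Fin n → ℕ
rank P? zero = 0
rank P? (suc i) = indicator (P? zero) + rank (P? ∘ suc) i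

rank<count : ∀ {n} {P : Fin n → Set} (P? : ∀ i → Dec (P i)) {i : Fin n} →
             P i → rank P? i < count P?
rank<count P? {zero} p with P? zero
... | yes _ = s≤s z≤n
... | no ¬p = contradiction p ¬p
rank<count P? {suc i} p = +-monoʳ-< (indicator (P? zero)) (rank<count (P? ∘ suc) p)

rank-strictMono : ∀ {n} {P : Fin n → Set} (P? : ∀ i → Dec (P i)) {i j : Fin n} →
                  i Fin.< j → P i → rank P? i < rank P? j
rank-strictMono P? {zero} {suc j} _ p with P? zero
... | yes _ = s≤s z≤n
... | no ¬p = contradiction p ¬p
rank-strictMono P? {suc i} {suc j} (s≤s i<j) p =
  +-monoʳ-< (indicator (P? zero)) (rank-strictMono (P? ∘ suc) i<j p)

rank-reflects-< : ∀ {n} {P : Fin n → Set} (P? : ∀ i → Dec (P i)) {i j : Fin n} → P j →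
                  rank P? i < rank P? j → i Fin.< j
rank-reflects-< P? {i} {j} pj r<r with FinP.<-cmp i j
... | tri< i<j _ _ = i<j
... | tri≈ _ refl _ = contradiction r<r (<-irrefl refl)
... | tri> _ _ j<i = contradiction r<r (<-asym (rank-strictMono P? j<i pj))

rank-injective : ∀ {n} {P : Fin n → Set} (P? : ∀ i → Dec (P i)) {i j : Fin n} →
                 P i → P j → rank P? i ≡ rank P? j → i ≡ j
rank-injective P? {i} {j} pi pj r≡r with FinP.<-cmp i j
... | tri< i<j _ _ = contradiction r≡r (<⇒≢ (rank-strictMono P? i<j pi))
... | tri≈ _ i≡j _ = i≡j
... | tri> _ _ j<i = contradiction (sym r≡r) (<⇒≢ (rank-strictMono P? j<i pj))

rank-surjective : ∀ {n} {P : Fin n → Set} (P? : ∀ i → Dec (P i)) (k : ℕ) →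
                  k < count P? → ∃ λ i → P i × rank P? i ≡ k
rank-surjective {suc n} P? k k<count with P? zero in eq
rank-surjective {suc n} P? zero _ | yes p = zero , p , refl
rank-surjective {suc n} P? (suc k) (s≤s k<count) | yes _ =
  let i , pi , ri = rank-surjective (P? ∘ suc) k k<count
  in suc i , pi , cong₂ _+_ (cong indicator eq) ri
rank-surjective {suc n} P? k k<count | no _ =
  let i , pi , ri = rank-surjective (P? ∘ suc) k k<count
  in suc i , pi , cong₂ _+_ (cong indicator eq) ri

countBelow : {P : ℕ → Set} → (∀ i → Dec (P i)) → ℕ → ℕ
countBelow P? zero = 0
countBelow P? (suc L) = countBelow P? L + indicator (P? L)

countBelow-≤ : {P : ℕ → Set} (P? : ∀ i → Dec (P i)) (L : ℕ) → countBelow P? L ≤ L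
countBelow-≤ P? zero = z≤n
countBelow-≤ P? (suc L) = subst (countBelow P? L + indicator (P? L) ≤_) (+-comm L 1)
  (+-mono-≤ (countBelow-≤ P? L) (indicator-mono (P? L) (yes tt) _))

countBelow-cons : {P : ℕ → Set} (P? : ∀ i → Dec (P i)) (L : ℕ) →
                  countBelow P? (suc L) ≡ indicator (P? 0) + countBelow (P? ∘ suc) L
countBelow-cons P? zero = +-comm 0 (indicator (P? 0))
countBelow-cons P? (suc L) = begin
  countBelow P? (suc L) + indicator (P? (suc L))
    ≡⟨ cong (_+ indicator (P? (suc L))) (countBelow-cons P? L) ⟩
  indicator (P? 0) + countBelow (P? ∘ suc) L + indicator (P? (suc L))
    ≡⟨ +-assoc (indicator (P? 0)) _ _ ⟩
  indicator (P? 0) + countBelow (P? ∘ suc) (suc L) ∎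
  where open ≡-Reasoning

countBelow-mono : {P Q : ℕ → Set} (P? : ∀ i → Dec (P i)) (Q? : ∀ i → Dec (Q i)) →
                  (∀ i → P i → Q i) → ∀ L → countBelow P? L ≤ countBelow Q? L
countBelow-mono P? Q? P⇒Q zero = z≤n
countBelow-mono P? Q? P⇒Q (suc L) =
  +-mono-≤ (countBelow-mono P? Q? P⇒Q L) (indicator-mono (P? L) (Q? L) (P⇒Q L))

funToFin-cong : ∀ {m n} {f g : Fin m → Fin n} →
                (∀ x → f x ≡ g x) → funToFin f ≡ funToFin g
funToFin-cong {zero} f≗g = refl
funToFin-cong {suc m} f≗g = cong₂ combine (f≗g zero) (funToFin-cong (f≗g ∘ suc))

finToFun-injective : ∀ {m n} (a b : Fin (n ^ m)) →
                     (∀ x → finToFun a x ≡ finToFun b x) → a ≡ b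
finToFun-injective {m} {n} a b same = begin
  a                             ≡⟨ sym (FinP.funToFin-finToFin {m} {n} a) ⟩
  funToFin (finToFun {n} {m} a) ≡⟨ funToFin-cong {m} {n} same ⟩
  funToFin (finToFun {n} {m} b) ≡⟨ FinP.funToFin-finToFin {m} {n} b ⟩
  b                             ∎
  where open ≡-Reasoning

funToFin-mono : ∀ {m n} (f g : Fin m → Fin n) → (∀ x → toℕ (f x) ≤ toℕ (g x)) →
                toℕ (funToFin f) ≤ toℕ (funToFin g)
funToFin-mono {zero} f g f≤g = ≤-refl
funToFin-mono {suc m} {n} f g f≤g
  rewrite FinP.toℕ-combine (f zero) (funToFin (f ∘ suc))
        | FinP.toℕ-combine (g zero) (funToFin (g ∘ suc)) =
  +-mono-≤ (*-monoʳ-≤ (n ^ m) (f≤g zero))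
           (funToFin-mono (f ∘ suc) (g ∘ suc) (f≤g ∘ suc))

finToFun-mono : ∀ {m n} (a b : Fin (n ^ m)) →
                (∀ x → toℕ (finToFun a x) ≤ toℕ (finToFun b x)) → toℕ a ≤ toℕ b
finToFun-mono {m} {n} a b a≤b =
  subst₂ _≤_ (cong toℕ (FinP.funToFin-finToFin {m} {n} a))
             (cong toℕ (FinP.funToFin-finToFin {m} {n} b))
         (funToFin-mono (finToFun {n} {m} a) (finToFun b) a≤b)

finToFun-combine-zero : ∀ {m r} (i : Fin m) (y : Fin (m ^ r)) →
                        finToFun {m} {suc r} (combine i y) zero ≡ i
finToFun-combine-zero {m} {r} i y = cong proj₁ (FinP.remQuot-combine {m} {m ^ r} i y)

finToFun-combine-suc : ∀ {m r} (i : Fin m) (y : Fin (m ^ r)) (c : Fin r) →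
                       finToFun {m} {suc r} (combine i y) (suc c) ≡ finToFun y c
finToFun-combine-suc {m} {r} i y c =
  cong (λ iy → finToFun (proj₂ iy) c) (FinP.remQuot-combine {m} {m ^ r} i y)

Fin2-ext : (u v : Fin 2) →
           (u ≡ suc zero → v ≡ suc zero) → (v ≡ suc zero → u ≡ suc zero) → u ≡ v
Fin2-ext zero zero _ _ = refl
Fin2-ext zero (suc zero) _ v⇒u with v⇒u refl
... | ()
Fin2-ext (suc zero) _ u⇒v _ = sym (u⇒v refl)

bit : {P : Set} → Dec P → Fin 2
bit (yes _) = suc zero
bit (no _) = zero

bit-sound : {P : Set} (p? : Dec P) → bit p? ≡ suc zero → P
bit-sound (yes p) _ = p

bit-complete : {P : Set} (p? : Dec P) → P → bit p? ≡ suc zero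
bit-complete (yes _) _ = refl
bit-complete (no ¬p) p = contradiction p ¬p

-- Subsets of Fin n, represented by the codes of their characteristic functions, so that
-- subsets can be enumerated and quantified over decidably.
module Subsets (n : ℕ) where

  Subset : Set
  Subset = Fin (2 ^ n)

  characteristic : Subset → Fin n → Fin 2
  characteristic = finToFun

  _∈_ : Fin n → Subset → Set
  x ∈ S = characteristic S x ≡ suc zero

  _∈?_ : ∀ x S → Dec (x ∈ S)
  x ∈? S = characteristic S x FinP.≟ suc zero

  _⊆_ : Subset → Subset → Set
  S ⊆ T = ∀ x → x ∈ S → x ∈ T

  ⊆-antisym : ∀ {S T} → S ⊆ T → T ⊆ S → S ≡ T
  ⊆-antisym {S} {T} S⊆T T⊆S =
    finToFun-injective {n} {2} S T (λ x → Fin2-ext _ _ (S⊆T x) (T⊆S x))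

  -- Ordering subsets by their codes extends inclusion to a linear order.
  ⊆⇒≤ : ∀ {S T} → S ⊆ T → toℕ S ≤ toℕ T
  ⊆⇒≤ {S} {T} S⊆T = finToFun-mono {n} {2} S T bit≤bit
    where
    bit≤bit : ∀ x → toℕ (characteristic S x) ≤ toℕ (characteristic T x)
    bit≤bit x with characteristic S x in x∈?S
    ... | zero = z≤n
    ... | suc zero rewrite S⊆T x x∈?S = ≤-refl

  tabulate : {P : Fin n → Set} → (∀ x → Dec (P x)) → Subset
  tabulate P? = funToFin (bit ∘ P?)

  ∈-tabulate⁺ : {P : Fin n → Set} (P? : ∀ x → Dec (P x)) {x : Fin n} →
                P x → x ∈ tabulate P?
  ∈-tabulate⁺ P? {x} px =
    trans (FinP.finToFun-funToFin {n} {2} (bit ∘ P?) x) (bit-complete (P? x) px)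

  ∈-tabulate⁻ : {P : Fin n → Set} (P? : ∀ x → Dec (P x)) {x : Fin n} →
                x ∈ tabulate P? → P x
  ∈-tabulate⁻ P? {x} x∈ =
    bit-sound (P? x) (trans (sym (FinP.finToFun-funToFin {n} {2} (bit ∘ P?) x)) x∈)

module Grid (m q : ℕ) where

  Point : Set
  Point = Fin (m ^ q)

  coord : Point → Fin q → Fin m
  coord = finToFun

  _≼_ : Point → Point → Set
  x ≼ y = ∀ c → toℕ (coord x c) ≤ toℕ (coord y c)

  _≼?_ : ∀ x y → Dec (x ≼ y)
  x ≼? y = FinP.all? (λ c → toℕ (coord x c) ≤? toℕ (coord y c))

  ≼-refl : ∀ x → x ≼ x
  ≼-refl x c = ≤-refl

  ≼-trans : ∀ {x y z} → x ≼ y → y ≼ z → x ≼ z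
  ≼-trans x≼y y≼z c = ≤-trans (x≼y c) (y≼z c)

  open Subsets (m ^ q) public

  IsDownSet : Subset → Set
  IsDownSet S = ∀ x y → y ≼ x → x ∈ S → y ∈ S

  IsDownSet? : ∀ S → Dec (IsDownSet S)
  IsDownSet? S =
    FinP.all? λ x → FinP.all? λ y → (y ≼? x) →-dec ((x ∈? S) →-dec (y ∈? S))

  tabulate-downSet : {P : Point → Set} (P? : ∀ x → Dec (P x)) →
                     (∀ x y → y ≼ x → P x → P y) → IsDownSet (tabulate P?)
  tabulate-downSet P? P-down x y y≼x x∈ =
    ∈-tabulate⁺ P? (P-down x y y≼x (∈-tabulate⁻ P? x∈))

  D : ℕ
  D = count IsDownSet?

  index : (S : Subset) → IsDownSet S → Fin D
  index S down = fromℕ< (rank<count IsDownSet? down)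

  index-injective : ∀ {S T} (dS : IsDownSet S) (dT : IsDownSet T) →
                    index S dS ≡ index T dT → S ≡ T
  index-injective dS dT same = rank-injective IsDownSet? dS dT
    (trans (sym (FinP.toℕ-fromℕ< _)) (trans (cong toℕ same) (FinP.toℕ-fromℕ< _)))

  downSet : ∀ k → k < D → Subset
  downSet k k<D = proj₁ (rank-surjective IsDownSet? k k<D)

  downSet-spec : ∀ k (k<D : k < D) →
                 IsDownSet (downSet k k<D) × rank IsDownSet? (downSet k k<D) ≡ k
  downSet-spec k k<D = proj₂ (rank-surjective IsDownSet? k k<D)

-- Put the D down-sets S_1, …, S_D of [m]^(r+1) on the vertices
-- 1, …, D in increasing order of their codes, a linear extension of inclusion.  For a < b the
-- set S_b is then not contained in S_a, so it has a new point x ∉ S_a.  Colour the triple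
-- a < b < c by a coordinate in which the new point x of (a, b) lies strictly below the new
-- point y of (b, c); it exists because y ∉ S_b ∋ x and S_b is a down-set.  Along a
-- monochromatic path on m + 2 vertices the m + 1 new points then have strictly increasing
-- coordinate in the colour of the path, which is impossible in [m].
module DownSetColouring (m r : ℕ) where
  open Grid m (suc r)

  ∅ : Subset
  ∅ = tabulate {P = λ _ → ⊥} (λ _ → no λ ())

  -- The vertex v ∈ [1, D] carries the down-set of rank v - 1 (other vertices are unused).
  vertex : ℕ → Subset
  vertex zero = ∅
  vertex (suc v) with v <? D
  ... | yes v<D = downSet v v<D
  ... | no _ = ∅

  vertex-spec : ∀ v → 1 ≤ v → v ≤ D →
                IsDownSet (vertex v) × rank IsDownSet? (vertex v) ≡ v ∸ 1
  vertex-spec (suc v) _ v<D with v <? D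
  ... | yes v<D = downSet-spec v v<D
  ... | no v≮D = contradiction v<D v≮D

  vertex-⊈ : ∀ {a b} → 1 ≤ a → a < b → b ≤ D → ¬ vertex b ⊆ vertex a
  vertex-⊈ {suc a} {suc b} _ (s≤s a<b) b≤D Vb⊆Va =
    <⇒≱ (rank-reflects-< IsDownSet? (proj₁ Vb) rank<rank) (⊆⇒≤ Vb⊆Va)
    where
    Va = vertex-spec (suc a) (s≤s z≤n) (≤-trans (s≤s (<⇒≤ a<b)) b≤D)
    Vb = vertex-spec (suc b) (s≤s z≤n) b≤D
    rank<rank : rank IsDownSet? (vertex (suc a)) < rank IsDownSet? (vertex (suc b))
    rank<rank = subst₂ _<_ (sym (proj₂ Va)) (sym (proj₂ Vb)) a<b

  newPoint : Subset → Subset → Maybe Point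
  newPoint S T with FinP.any? (λ x → (x ∈? T) ×-dec ¬? (x ∈? S))
  ... | yes (x , _) = just x
  ... | no _ = nothing

  newPoint-sound : ∀ S T {x} → newPoint S T ≡ just x → x ∈ T × ¬ x ∈ S
  newPoint-sound S T e with FinP.any? (λ x → (x ∈? T) ×-dec ¬? (x ∈? S))
  newPoint-sound S T refl | yes (_ , new) = new

  newPoint-complete : ∀ S T → ¬ T ⊆ S → ∃ λ x → newPoint S T ≡ just x
  newPoint-complete S T T⊈S with FinP.any? (λ x → (x ∈? T) ×-dec ¬? (x ∈? S))
  ... | yes (x , _) = x , refl
  ... | no none = contradiction T⊆S T⊈S
    where
    T⊆S : T ⊆ S
    T⊆S x x∈T with x ∈? S
    ... | yes x∈S = x∈S
    ... | no x∉S = contradiction (x , x∈T , x∉S) none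

  ascent : Point → Point → Fin (suc r)
  ascent x y with FinP.any? (λ c → toℕ (coord x c) <? toℕ (coord y c))
  ... | yes (c , _) = c
  ... | no _ = zero

  ascent-spec : ∀ x y → ¬ y ≼ x →
                toℕ (coord x (ascent x y)) < toℕ (coord y (ascent x y))
  ascent-spec x y y⋠x with FinP.any? (λ c → toℕ (coord x c) <? toℕ (coord y c))
  ... | yes (_ , x<y) = x<y
  ... | no none = contradiction (λ c → ≮⇒≥ (λ x<y → none (c , x<y))) y⋠x

  step : ℕ → ℕ → Maybe Point
  step a b = newPoint (vertex a) (vertex b)

  step-defined : ∀ {a b} → 1 ≤ a → a < b → b ≤ D → ∃ λ x → step a b ≡ just x
  step-defined 1≤a a<b b≤D = newPoint-complete _ _ (vertex-⊈ 1≤a a<b b≤D)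

  colourOf : Maybe Point → Maybe Point → Fin (suc r)
  colourOf (just x) (just y) = ascent x y
  colourOf _ _ = zero

  χ : Colouring3 (suc r)
  χ a b c = colourOf (step a b) (step b c)

  ascends : ∀ a b c {x y} → IsDownSet (vertex b) →
            step a b ≡ just x → step b c ≡ just y →
            toℕ (coord x (χ a b c)) < toℕ (coord y (χ a b c))
  ascends a b c {x} {y} down ex ey rewrite ex | ey =
    ascent-spec x y (λ y≼x → proj₂ (newPoint-sound _ _ ey)
                               (down x y y≼x (proj₁ (newPoint-sound _ _ ex))))

  noPath : ∀ M → M ≤ D → ¬ Arrows3 (suc r) (suc (suc m)) M
  noPath M M≤D arrows with arrows χ
  ... | j , col , (increasing , inRange) , mono =
    let _ , _ , m≤xm = climb m ≤-refl in <-irrefl refl (≤-<-trans m≤xm (FinP.toℕ<n _))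
    where
    vertex-ok : ∀ i → i ≤ suc m → 1 ≤ j i × j i ≤ D
    vertex-ok i i≤ = let 1≤ , ≤M = inRange i (s≤s i≤) in 1≤ , ≤-trans ≤M M≤D
    edge : ∀ i → i ≤ m → ∃ λ x → step (j i) (j (suc i)) ≡ just x
    edge i i≤m = step-defined (proj₁ (vertex-ok i (m≤n⇒m≤1+n i≤m)))
                              (increasing i (s≤s (s≤s i≤m)))
                              (proj₂ (vertex-ok (suc i) (s≤s i≤m)))
    climb : ∀ i → i ≤ m →
            ∃ λ x → step (j i) (j (suc i)) ≡ just x × i ≤ toℕ (coord x col)
    climb zero 0≤m = proj₁ (edge 0 0≤m) , proj₂ (edge 0 0≤m) , z≤n
    climb (suc i) i<m =
      let x , ex , i≤x = climb i (<⇒≤ i<m)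
          y , ey = edge (suc i) i<m
          1≤v , v≤D = vertex-ok (suc i) (s≤s (<⇒≤ i<m))
          x<y = subst (λ c → toℕ (coord x c) < toℕ (coord y c)) (mono i (s≤s (s≤s i<m)))
                      (ascends (j i) (j (suc i)) (j (suc (suc i)))
                               (proj₁ (vertex-spec (j (suc i)) 1≤v v≤D)) ex ey)
      in y , ey , ≤-<-trans i≤x x<y

-- Monochromatic paths with prescribed first two vertices, in a recursive form whose
-- existence is decidable: StartsPath k a b says that there are b < x_1 < … < x_k ≤ N such
-- that every triple of consecutive vertices of a, b, x_1, …, x_k has colour c.
module ColouredPaths {q : ℕ} (χ : Colouring3 q) (N : ℕ) (c : Fin q) where

  StartsPath : ℕ → ℕ → ℕ → Set
  StartsPath zero a b = ⊤
  StartsPath (suc k) a b = ∃ λ d → d < suc N × b < d × χ a b d ≡ c × StartsPath k b d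

  StartsPath? : ∀ k a b → Dec (StartsPath k a b)
  StartsPath? zero a b = yes tt
  StartsPath? (suc k) a b =
    anyUpTo? (λ d → (b <? d) ×-dec ((χ a b d FinP.≟ c) ×-dec StartsPath? k b d)) (suc N)

  StartsPath-cons : ∀ {k a b d} → b < d → d ≤ N → χ a b d ≡ c →
                    StartsPath k b d → StartsPath (suc k) a b
  StartsPath-cons b<d d≤N colour path = _ , s≤s d≤N , b<d , colour , path

  vertices : ∀ k a b → StartsPath k a b → ℕ → ℕ
  vertices k a b _ zero = a
  vertices zero a b _ (suc i) = b
  vertices (suc k) a b (d , _ , _ , _ , rest) (suc i) = vertices k b d rest i

  vertices-second : ∀ k a b (p : StartsPath k a b) → vertices k a b p 1 ≡ b
  vertices-second zero a b p = refl
  vertices-second (suc k) a b p = refl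

  vertices-increasing : ∀ k a b (p : StartsPath k a b) → a < b → ∀ i → suc i < 2 + k →
                        vertices k a b p i < vertices k a b p (suc i)
  vertices-increasing k a b p a<b zero _ rewrite vertices-second k a b p = a<b
  vertices-increasing zero a b p a<b (suc i) (s≤s (s≤s ()))
  vertices-increasing (suc k) a b (d , _ , b<d , _ , rest) a<b (suc i) (s≤s i<) =
    vertices-increasing k b d rest b<d i i<

  vertices-bounded : ∀ k a b (p : StartsPath k a b) → a < b → b ≤ N → ∀ i → i < 2 + k →
                     a ≤ vertices k a b p i × vertices k a b p i ≤ N
  vertices-bounded k a b p a<b b≤N zero _ = ≤-refl , ≤-trans (<⇒≤ a<b) b≤N
  vertices-bounded zero a b p a<b b≤N (suc i) _ = <⇒≤ a<b , b≤N
  vertices-bounded (suc k) a b (d , s≤s d≤N , b<d , _ , rest) a<b b≤N (suc i) (s≤s i<) =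
    let b≤v , v≤N = vertices-bounded k b d rest b<d d≤N i i<
    in ≤-trans (<⇒≤ a<b) b≤v , v≤N

  vertices-monochromatic : ∀ k a b (p : StartsPath k a b) → ∀ i → 2 + i < 2 + k →
    χ (vertices k a b p i) (vertices k a b p (suc i)) (vertices k a b p (suc (suc i))) ≡ c
  vertices-monochromatic zero a b p i (s≤s (s≤s ()))
  vertices-monochromatic (suc k) a b (d , _ , _ , colour , rest) zero _
    rewrite vertices-second k b d rest = colour
  vertices-monochromatic (suc k) a b (d , _ , _ , _ , rest) (suc i) (s≤s i<) =
    vertices-monochromatic k b d rest i i<

  realise : ∀ {k a b} → 1 ≤ a → a < b → b ≤ N → (p : StartsPath k a b) →
            IsMonotonePath N (2 + k) (vertices k a b p) ×
            IsMonochromatic3 χ (2 + k) (vertices k a b p) c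
  realise {k} {a} {b} 1≤a a<b b≤N p =
    (vertices-increasing k a b p a<b , inRange) , vertices-monochromatic k a b p
    where
    inRange : ∀ i → i < 2 + k → 1 ≤ vertices k a b p i × vertices k a b p i ≤ N
    inRange i i< = let a≤v , v≤N = vertices-bounded k a b p a<b b≤N i i<
                   in ≤-trans 1≤a a≤v , v≤N

-- N_3(r + 1, m + 2) ≤ D + 1 for m ≥ 2.  Let χ colour the triples of [D + 1] and suppose there
-- is no monochromatic path on m + 2 vertices.  Give the pair a < b the point of [m]^(r+1)
-- whose c-th coordinate counts the lengths 1 ≤ k ≤ m - 1 for which a path a, b, x_1, …, x_k of
-- colour c exists.  If c is the colour of a < b < d, every such path starting with b, d
-- extends to one starting with a, b, and the longest one (k = m - 1) cannot occur, so the
-- c-th label drops strictly from (a, b) to (b, d).  Hence the point of (a, b) lies below the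
-- point of no pair (b, d), and the down-sets generated by the points of the pairs (b, d),
-- d > b, differ for different b: D + 1 distinct down-sets, a contradiction.
module ArrowBound (m2 r : ℕ) (χ : Colouring3 (suc r)) where
  m1 : ℕ
  m1 = suc m2
  m : ℕ
  m = suc m1

  open Grid m (suc r)

  N : ℕ
  N = suc D

  open ColouredPaths χ N

  label : Fin (suc r) → ℕ → ℕ → ℕ
  label c a b = countBelow (λ i → StartsPath? c (suc i) a b) m1

  label<m : ∀ c a b → label c a b < m
  label<m c a b = s≤s (countBelow-≤ (λ i → StartsPath? c (suc i) a b) m1)

  labels : ℕ → ℕ → Fin (suc r) → Fin m
  labels a b c = fromℕ< (label<m c a b)

  point : ℕ → ℕ → Point
  point a b = funToFin (labels a b)

  coord-point : ∀ a b c → toℕ (coord (point a b) c) ≡ label c a b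
  coord-point a b c = begin
    toℕ (coord (point a b) c)     ≡⟨ cong toℕ (FinP.finToFun-funToFin (labels a b) c) ⟩
    toℕ (fromℕ< (label<m c a b))  ≡⟨ FinP.toℕ-fromℕ< (label<m c a b) ⟩
    label c a b                   ∎
    where open ≡-Reasoning

  Below : ℕ → Point → Set
  Below b x = ∃ λ d → d < suc N × b < d × x ≼ point b d

  Below? : ∀ b x → Dec (Below b x)
  Below? b x = anyUpTo? (λ d → (b <? d) ×-dec (x ≼? point b d)) (suc N)

  shadow : ℕ → Subset
  shadow b = tabulate (Below? b)

  shadow-downSet : ∀ b → IsDownSet (shadow b)
  shadow-downSet b = tabulate-downSet (Below? b)
    λ { x y y≼x (d , d≤N , b<d , x≼) → d , d≤N , b<d , ≼-trans y≼x x≼ }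

  LongPath : Set
  LongPath = ∃ λ b → b < suc N × ∃ λ a → a < b × 1 ≤ a × ∃ λ c → StartsPath c m a b

  LongPath? : Dec LongPath
  LongPath? = anyUpTo? (λ b → anyUpTo? (λ a → (1 ≤? a) ×-dec
                                                FinP.any? (λ c → StartsPath? c m a b)) b)
                       (suc N)

  module NoLongPath (none : ¬ LongPath) where

    label-decreases : ∀ {a b d} → 1 ≤ a → a < b → b < d → d ≤ N →
                      label (χ a b d) b d < label (χ a b d) a b
    label-decreases {a} {b} {d} 1≤a a<b b<d d≤N = begin-strict
      label col b d               ≡⟨ cong (countBelow next? m2 +_) (indicator-false _ longest) ⟩
      countBelow next? m2 + 0     ≡⟨ +-identityʳ _ ⟩
      countBelow next? m2         ≤⟨ countBelow-mono next? (this? ∘ suc) extend m2 ⟩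
      tail                        <⟨ n<1+n tail ⟩
      1 + tail                    ≡⟨ cong (_+ tail) (sym (indicator-true (this? 0) first)) ⟩
      indicator (this? 0) + tail  ≡⟨ sym (countBelow-cons this? m2) ⟩
      label col a b               ∎
      where
      open ≤-Reasoning
      col = χ a b d
      this? = λ i → StartsPath? col (suc i) a b
      next? = λ i → StartsPath? col (suc i) b d
      tail = countBelow (this? ∘ suc) m2
      extend : ∀ i → StartsPath col (suc i) b d → StartsPath col (suc (suc i)) a b
      extend i = StartsPath-cons col b<d d≤N refl
      first : StartsPath col 1 a b
      first = StartsPath-cons col b<d d≤N refl tt
      longest : ¬ StartsPath col m1 b d
      longest p = none (b , s≤s (≤-trans (<⇒≤ b<d) d≤N) , a , a<b , 1≤a , col ,
                        StartsPath-cons col b<d d≤N refl p)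

    shadowIndex : Fin N → Fin D
    shadowIndex i = index (shadow (suc (toℕ i))) (shadow-downSet _)

    sameShadow-impossible : ∀ {i j : Fin N} → i Fin.< j → shadowIndex i ≡ shadowIndex j → ⊥
    sameShadow-impossible {i} {j} i<j same =
      <⇒≱ (label-decreases (s≤s z≤n) a<b b<d (≤-pred d<N)) label≤label
      where
      a = suc (toℕ i)
      b = suc (toℕ j)
      a<b : a < b
      a<b = s≤s i<j
      shadow≡ : shadow a ≡ shadow b
      shadow≡ = index-injective (shadow-downSet a) (shadow-downSet b) same
      below : Below b (point a b)
      below = ∈-tabulate⁻ (Below? b) (subst (point a b ∈_) shadow≡
                (∈-tabulate⁺ (Below? a) (b , s≤s (FinP.toℕ<n j) , a<b , ≼-refl _)))
      d = proj₁ below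
      d<N = proj₁ (proj₂ below)
      b<d = proj₁ (proj₂ (proj₂ below))
      label≤label : label (χ a b d) a b ≤ label (χ a b d) b d
      label≤label = subst₂ _≤_ (coord-point a b _) (coord-point b d _)
                               (proj₂ (proj₂ (proj₂ below)) (χ a b d))

    impossible : ⊥
    impossible = let _ , _ , i<j , same = FinP.pigeonhole (n<1+n D) shadowIndex
                 in sameShadow-impossible i<j same

  MonochromaticPath : Set
  MonochromaticPath =
    ∃[ j ] ∃[ c ] (IsMonotonePath N (suc (suc m)) j × IsMonochromatic3 χ (suc (suc m)) j c)

  arrows : MonochromaticPath
  arrows = fromDecision LongPath?
    where
    fromDecision : Dec LongPath → MonochromaticPath
    fromDecision (yes (b , s≤s b≤N , a , a<b , 1≤a , c , p)) =
      vertices c m a b p , c , realise c 1≤a a<b b≤N p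
    fromDecision (no none) = ⊥-elim (NoLongPath.impossible none)

firstFailure : ∀ {n} {P : Fin n → Set} → (∀ i → Dec (P i)) → Fin (suc n)
firstFailure {zero} _ = zero
firstFailure {suc n} P? with P? zero
... | yes _ = suc (firstFailure (P? ∘ suc))
... | no _ = zero

firstFailure-below : ∀ {n} {P : Fin n → Set} (P? : ∀ i → Dec (P i)) (i : Fin n) →
                     toℕ i < toℕ (firstFailure P?) → P i
firstFailure-below {suc n} P? i i< with P? zero
firstFailure-below {suc n} P? zero _ | yes p = p
firstFailure-below {suc n} P? (suc i) (s≤s i<) | yes _ = firstFailure-below (P? ∘ suc) i i<

firstFailure-above : ∀ {n} {P : Fin n → Set} (P? : ∀ i → Dec (P i)) (i : Fin n) →
                     toℕ (firstFailure P?) ≤ toℕ i →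
                     ∃ λ j → toℕ j ≤ toℕ i × ¬ P j
firstFailure-above {suc n} P? i ≤i with P? zero
firstFailure-above {suc n} P? (suc i) (s≤s ≤i) | yes _ =
  let j , j≤i , ¬pj = firstFailure-above (P? ∘ suc) i ≤i in suc j , s≤s j≤i , ¬pj
firstFailure-above {suc n} P? i _ | no ¬p0 = zero , z≤n , ¬p0

-- Writing points as (i, y) with
-- i ∈ [m] and y ∈ [m]^r, every column {i ∣ (i, y) ∈ S} of a down-set S is an initial segment
-- of [m], so S is determined by its heights, a function [m]^r → [m + 1].
module Heights (m r : ℕ) where
  open Grid m (suc r)

  height : Subset → Fin (m ^ r) → Fin (suc m)
  height S y = firstFailure (λ i → combine i y ∈? S)

  combine-≼ : ∀ {i j} y → toℕ j ≤ toℕ i → combine j y ≼ combine i y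
  combine-≼ {i} {j} y j≤i zero
    rewrite finToFun-combine-zero {m} {r} i y | finToFun-combine-zero {m} {r} j y = j≤i
  combine-≼ {i} {j} y j≤i (suc c)
    rewrite finToFun-combine-suc {m} {r} i y c | finToFun-combine-suc {m} {r} j y c = ≤-refl

  ∈⇒<height : ∀ {S} → IsDownSet S → ∀ i y → combine i y ∈ S → toℕ i < toℕ (height S y)
  ∈⇒<height {S} down i y i∈ with toℕ i <? toℕ (height S y)
  ... | yes i< = i<
  ... | no i≮ =
    let j , j≤i , j∉ = firstFailure-above (λ i → combine i y ∈? S) i (≮⇒≥ i≮)
    in contradiction (down (combine i y) (combine j y) (combine-≼ y j≤i) i∈) j∉

  <height⇒∈ : ∀ S i y → toℕ i < toℕ (height S y) → combine i y ∈ S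
  <height⇒∈ S i y = firstFailure-below (λ i → combine i y ∈? S) i

  heights-⊆ : ∀ {S T} → IsDownSet S → (∀ y → height S y ≡ height T y) → S ⊆ T
  heights-⊆ {S} {T} down same x x∈S with FinP.combine-surjective {m} {m ^ r} x
  ... | i , y , refl =
    <height⇒∈ T i y (subst (λ h → toℕ i < toℕ h) (same y) (∈⇒<height down i y x∈S))

  heightCode : Fin D → Fin (suc m ^ (m ^ r))
  heightCode k = funToFin (height (downSet (toℕ k) (FinP.toℕ<n k)))

  heightCode-injective : ∀ {k l} → heightCode k ≡ heightCode l → k ≡ l
  heightCode-injective {k} {l} same = FinP.toℕ-injective (begin
    toℕ k                               ≡⟨ sym (proj₂ Sk) ⟩
    rank IsDownSet? (downSet (toℕ k) _) ≡⟨ cong (rank IsDownSet?) S≡T ⟩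
    rank IsDownSet? (downSet (toℕ l) _) ≡⟨ proj₂ Sl ⟩
    toℕ l                               ∎)
    where
    open ≡-Reasoning
    Sk = downSet-spec (toℕ k) (FinP.toℕ<n k)
    Sl = downSet-spec (toℕ l) (FinP.toℕ<n l)
    sameHeights : ∀ y → height (downSet (toℕ k) _) y ≡ height (downSet (toℕ l) _) y
    sameHeights y = trans (sym (FinP.finToFun-funToFin _ y))
                          (trans (cong (λ h → finToFun h y) same) (FinP.finToFun-funToFin _ y))
    S≡T : downSet (toℕ k) (FinP.toℕ<n k) ≡ downSet (toℕ l) (FinP.toℕ<n l)
    S≡T = ⊆-antisym (heights-⊆ (proj₁ Sk) sameHeights)
                    (heights-⊆ (proj₁ Sl) (λ y → sym (sameHeights y)))

  D≤ : D ≤ suc m ^ (m ^ r)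
  D≤ = FinP.injective⇒≤ heightCode-injective

sumFin : ∀ {r} → (Fin r → ℕ) → ℕ
sumFin {zero} _ = 0
sumFin {suc r} f = f zero + sumFin (f ∘ suc)

sumFin-mono : ∀ {r} (f g : Fin r → ℕ) → (∀ c → f c ≤ g c) → sumFin f ≤ sumFin g
sumFin-mono {zero} f g f≤g = z≤n
sumFin-mono {suc r} f g f≤g =
  +-mono-≤ (f≤g zero) (sumFin-mono (f ∘ suc) (g ∘ suc) (f≤g ∘ suc))

sumFin-bound : ∀ {r} t (f : Fin r → ℕ) → (∀ c → f c ≤ t) → sumFin f ≤ r * t
sumFin-bound {zero} t f f≤t = z≤n
sumFin-bound {suc r} t f f≤t =
  +-mono-≤ (f≤t zero) (sumFin-bound t (f ∘ suc) (f≤t ∘ suc))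

sumFin-rigid : ∀ {r} (f g : Fin r → ℕ) → (∀ c → f c ≤ g c) → sumFin g ≤ sumFin f →
               ∀ c → f c ≡ g c
sumFin-rigid {suc r} f g f≤g Σg≤Σf zero = ≤-antisym (f≤g zero)
  (+-cancelʳ-≤ (sumFin (g ∘ suc)) (g zero) (f zero)
    (≤-trans Σg≤Σf (+-monoʳ-≤ (f zero) (sumFin-mono (f ∘ suc) (g ∘ suc) (f≤g ∘ suc)))))
sumFin-rigid {suc r} f g f≤g Σg≤Σf (suc c) =
  sumFin-rigid (f ∘ suc) (g ∘ suc) (f≤g ∘ suc)
    (+-cancelˡ-≤ (f zero) _ _ (≤-trans (+-monoˡ-≤ (sumFin (g ∘ suc)) (f≤g zero)) Σg≤Σf)) c

-- The
-- points (r t - Σ y, y) with y ∈ [t + 1]^r form an antichain, and different subsets of an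
-- antichain generate different down-sets.
module Antichain (m r t : ℕ) (t<m : t < m) (rt<m : r * t < m) where
  open Grid m (suc r)

  T : ℕ
  T = suc t ^ r

  open Subsets T using ()
    renaming (Subset to Family; _∈_ to _∈ᶠ_; _∈?_ to _∈ᶠ?_; ⊆-antisym to ⊆ᶠ-antisym)

  digits : Fin T → Fin r → Fin (suc t)
  digits = finToFun

  weight : Fin T → ℕ
  weight y = sumFin (λ c → toℕ (digits y c))

  weight≤ : ∀ y → weight y ≤ r * t
  weight≤ y = sumFin-bound t _ (λ c → ≤-pred (FinP.toℕ<n (digits y c)))

  headCoord : Fin T → Fin m
  headCoord y = fromℕ< (≤-<-trans (m∸n≤m (r * t) (weight y)) rt<m)

  tailCoords : Fin T → Fin r → Fin m
  tailCoords y c = inject≤ (digits y c) t<m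

  antichainPoint : Fin T → Point
  antichainPoint y = combine (headCoord y) (funToFin (tailCoords y))

  coord-head : ∀ y → toℕ (coord (antichainPoint y) zero) ≡ r * t ∸ weight y
  coord-head y =
    trans (cong toℕ (finToFun-combine-zero {m} {r} (headCoord y) _)) (FinP.toℕ-fromℕ< _)

  coord-tail : ∀ y c → toℕ (coord (antichainPoint y) (suc c)) ≡ toℕ (digits y c)
  coord-tail y c = begin
    toℕ (coord (antichainPoint y) (suc c))
      ≡⟨ cong toℕ (finToFun-combine-suc {m} {r} (headCoord y) _ c) ⟩
    toℕ (finToFun (funToFin (tailCoords y)) c)
      ≡⟨ cong toℕ (FinP.finToFun-funToFin (tailCoords y) c) ⟩
    toℕ (inject≤ (digits y c) t<m)
      ≡⟨ FinP.toℕ-inject≤ (digits y c) t<m ⟩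
    toℕ (digits y c) ∎
    where open ≡-Reasoning

  antichain : ∀ y z → antichainPoint y ≼ antichainPoint z → y ≡ z
  antichain y z y≼z = finToFun-injective {r} {suc t} y z
    (λ c → FinP.toℕ-injective (sumFin-rigid _ _ digits≤ weight-z≤y c))
    where
    digits≤ : ∀ c → toℕ (digits y c) ≤ toℕ (digits z c)
    digits≤ c = subst₂ _≤_ (coord-tail y c) (coord-tail z c) (y≼z (suc c))
    head≤ : r * t ∸ weight y ≤ r * t ∸ weight z
    head≤ = subst₂ _≤_ (coord-head y) (coord-head z) (y≼z zero)
    weight-z≤y : weight z ≤ weight y
    weight-z≤y = subst₂ _≤_ (m∸[m∸n]≡n (weight≤ z)) (m∸[m∸n]≡n (weight≤ y))
                            (∸-monoʳ-≤ (r * t) head≤)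

  BelowFamily : Family → Point → Set
  BelowFamily A x = ∃ λ y → y ∈ᶠ A × x ≼ antichainPoint y

  BelowFamily? : ∀ A x → Dec (BelowFamily A x)
  BelowFamily? A x = FinP.any? (λ y → (y ∈ᶠ? A) ×-dec (x ≼? antichainPoint y))

  generated : Family → Subset
  generated A = tabulate (BelowFamily? A)

  generated-downSet : ∀ A → IsDownSet (generated A)
  generated-downSet A = tabulate-downSet (BelowFamily? A)
    λ { x x′ x′≼x (y , y∈A , x≼) → y , y∈A , ≼-trans x′≼x x≼ }

  generated-reflects-⊆ : ∀ A B → generated A ≡ generated B → ∀ y → y ∈ᶠ A → y ∈ᶠ B
  generated-reflects-⊆ A B same y y∈A =
    let z , z∈B , y≼z = ∈-tabulate⁻ (BelowFamily? B) (subst (antichainPoint y ∈_) same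
                          (∈-tabulate⁺ (BelowFamily? A) (y , y∈A , ≼-refl _)))
    in subst (_∈ᶠ B) (sym (antichain y z y≼z)) z∈B

  generatedIndex : Family → Fin D
  generatedIndex A = index (generated A) (generated-downSet A)

  generatedIndex-injective : ∀ {A B} → generatedIndex A ≡ generatedIndex B → A ≡ B
  generatedIndex-injective {A} {B} same =
    ⊆ᶠ-antisym (generated-reflects-⊆ A B sameDownSet)
               (generated-reflects-⊆ B A (sym sameDownSet))
    where
    sameDownSet : generated A ≡ generated B
    sameDownSet = index-injective (generated-downSet A) (generated-downSet B) same

  D≥ : 2 ^ T ≤ D
  D≥ = FinP.injective⇒≤ generatedIndex-injective

^-distribʳ-* : ∀ a b e → (a * b) ^ e ≡ a ^ e * b ^ e
^-distribʳ-* a b zero = refl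
^-distribʳ-* a b (suc e) = begin
  a * b * (a * b) ^ e     ≡⟨ cong (a * b *_) (^-distribʳ-* a b e) ⟩
  a * b * (a ^ e * b ^ e) ≡⟨ interchange a b (a ^ e) (b ^ e) ⟩
  a ^ suc e * b ^ suc e   ∎
  where open ≡-Reasoning

suc-^-≤ : ∀ x e → 1 ≤ e → suc (x ^ e) ≤ suc x ^ e
suc-^-≤ x (suc e) _ = +-mono-≤ (m^n>0 (suc x) e) (*-monoʳ-≤ x (^-monoˡ-≤ e (n≤1+n x)))

-- For 1 ≤ r ≤ k the width t = ⌊k / r⌋ satisfies t < k + 1 and r t < k + 1, so that the
-- antichain of Antichain fits into [k + 1]^(r+1), and k + 3 ≤ (t + 1)(r + 1).
width : ∀ k r .{{_ : NonZero r}} → r ≤ k →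
        ∃ λ t → t < suc k × r * t < suc k × 3 + k ≤ suc t * suc r
width k r r≤k = t , s≤s (m/n≤m k r) , s≤s (subst (_≤ k) (*-comm t r) (m/n*n≤m k r)) , k+3≤
  where
  t = k / r
  k<[t+1]r : suc k ≤ suc t * r
  k<[t+1]r = subst (λ k′ → suc k′ ≤ r + t * r) (sym (m≡m%n+[m/n]*n k r))
                   (+-monoˡ-≤ (t * r) (m%n<n k r))
  k+3≤ : 3 + k ≤ suc t * suc r
  k+3≤ = subst (3 + k ≤_) (sym (*-suc (suc t) r))
               (+-mono-≤ (s≤s (m≥n⇒m/n>0 r≤k)) k<[t+1]r)

N3-exact : ∀ m r → IsN3 (suc r) (4 + m) (suc (Grid.D (2 + m) (suc r)))
N3-exact m r = (λ χ → ArrowBound.arrows m r χ) ,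
               (λ M M<N → DownSetColouring.noPath (2 + m) r M (≤-pred M<N))

N-upper : ∀ m r → suc (Grid.D (suc m) (suc r)) ≤ (3 + m) ^ ((3 + m) ^ r)
N-upper m r = begin
  suc (Grid.D (suc m) (suc r))  ≤⟨ s≤s (Heights.D≤ (suc m) r) ⟩
  suc ((2 + m) ^ (suc m ^ r))   ≤⟨ suc-^-≤ (2 + m) (suc m ^ r) (m^n>0 (suc m) r) ⟩
  (3 + m) ^ (suc m ^ r)         ≤⟨ ^-monoʳ-≤ (3 + m) (^-monoˡ-≤ r (m≤n+m (suc m) 2)) ⟩
  (3 + m) ^ ((3 + m) ^ r)       ∎
  where open ≤-Reasoning

N-lower : ∀ k r .{{_ : NonZero r}} → r ≤ k →
          2 ^ ((3 + k) ^ r) ≤ suc (Grid.D (suc k) (suc r)) ^ (suc r ^ r)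
N-lower k r r≤k = begin
  2 ^ ((3 + k) ^ r)                ≤⟨ ^-monoʳ-≤ 2 (^-monoˡ-≤ r k+3≤) ⟩
  2 ^ ((suc t * suc r) ^ r)        ≡⟨ cong (2 ^_) (^-distribʳ-* (suc t) (suc r) r) ⟩
  2 ^ (suc t ^ r * suc r ^ r)      ≡⟨ sym (^-*-assoc 2 (suc t ^ r) (suc r ^ r)) ⟩
  (2 ^ (suc t ^ r)) ^ (suc r ^ r)  ≤⟨ ^-monoˡ-≤ (suc r ^ r) (m≤n⇒m≤1+n 2^T≤D) ⟩
  suc (Grid.D (suc k) (suc r)) ^ (suc r ^ r) ∎
  where
  open ≤-Reasoning
  t = proj₁ (width k r r≤k)
  k+3≤ = proj₂ (proj₂ (proj₂ (width k r r≤k)))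
  2^T≤D : 2 ^ (suc t ^ r) ≤ Grid.D (suc k) (suc r)
  2^T≤D = Antichain.D≥ (suc k) r t (proj₁ (proj₂ (width k r r≤k)))
                                   (proj₁ (proj₂ (proj₂ (width k r r≤k))))

-- For q ≥ 2 and n ≥ q + 2, N_3(q, n) exists (it is one more than the number of down-sets
-- of [n - 2]^q) and 2^((n/q)^(q-1)) ≤ N_3(q, n) ≤ n^(n^(q-1)); the lower bound is stated
-- without division as 2^(n^(q-1)) ≤ N_3(q, n)^(q^(q-1)).
theorem2 : (q n : ℕ) → 2 ≤ q → q + 2 ≤ n →
    ∃[ N ] (IsN3 q n N ×
    (2 ^ (n ^ (q ∸ 1)) ≤ N ^ (q ^ (q ∸ 1))) ×
    (N ≤ n ^ (n ^ (q ∸ 1))))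
theorem2 (suc zero) _ (s≤s ()) _
theorem2 (suc (suc r)) n _ q+2≤n with subst (_≤ n) (+-comm (suc (suc r)) 2) q+2≤n
theorem2 (suc (suc r)) _ _ _ | s≤s (s≤s (s≤s (s≤s {n = m} r≤m))) =
  suc (Grid.D (2 + m) (2 + r)) ,
  N3-exact m (suc r) , N-lower (suc m) (suc r) (s≤s r≤m) , N-upper (suc m) (suc r)
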